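{- Let $P,Q\in\mathbb{Z}$ with $PQ=0$, let $p$ be a prime and let $r\geq 1$ be an integer. Then \[ \mathcal{L}(P,Q,p^{ -r}) = \begin{cases} \{0\} & \text{if } P\neq 0,\ Q=0,\ p\nmid P,\\ S_{\lceil r/\nu_p(P)\rceil+1} & \text{if } P\neq 0,\ Q=0,\ p\mid P,\\ \langle 2\rangle & \text{if } P=0,\ Q\neq 0,\ p\nmid Q,\\ \langle 2,\ 2\lceil r/\nu_p(Q)\rceil+1\rangle & \text{if } P=0,\ Q\neq 0,\ p\mid Q,\\ S_2 & \text{if } P=Q=0. \end{cases} \]
   Context: $\mathbb{N}=\{0,1,2,\ldots\}$. For $P,Q\in\mathbb{Z}$, the Lucas sequence $U_n=U_n(P,Q)$ is defined by $U_0=0$, $U_1=1$, $U_{n+2}=PU_{n+1}-QU_n$. For $R\in\mathbb{Q}$, $\mathcal{L}(P,Q,R)=\{n\in\mathbb{N} : U_nR\in\mathbb{Z}\}$; thus $\mathcal{L}(P,Q,p^{ -r})=\{n\in\mathbb{N}:\nu_p(U_n)\geq r\}$, where $\nu_p$ is the $p$-adic valuation ($\nu_p(0)=\infty$). $\langle\cdot\rangle$ denotes the additive subsemigroup of $\mathbb{N}$ generated by the given elements (including $0$). For $m\geq 1$, $S_m=\{0,m,m+1,m+2,\ldots\}$. -}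

module Defs where

open import Data.Nat as ℕ using (ℕ; zero; suc; _≤_; NonZero)
import Data.Nat.DivMod as ℕD
open import Data.Integer using (ℤ; +_; _-_; _*_; _^_)
open import Data.Integer.Divisibility using (_∣_)
open import Data.Product using (Σ; _×_; ∃)
open import Data.Sum using (_⊎_)
open import Relation.Binary.PropositionalEquality using (_≡_)
open import Relation.Nullary using (¬_)

U : ℤ → ℤ → ℕ → ℤ
U P Q zero = + 0
U P Q (suc zero) = + 1
U P Q (suc (suc n)) = P * U P Q (suc n) - Q * U P Q n

-- n ∈ L(P,Q,p^{-r})  iff  U_n p^{-r} ∈ ℤ  iff  p^r ∣ U_n  (covers U_n = 0, ν_p(0) = ∞)
InL : ℤ → ℤ → ℕ → ℕ → ℕ → Set
InL P Q p r n = (+ p) ^ r ∣ U P Q n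

IsVal : ℕ → ℤ → ℕ → Set
IsVal p a v = ((+ p) ^ v ∣ a) × ¬ ((+ p) ^ suc v ∣ a)

ceilDiv : (r v : ℕ) → .{{NonZero v}} → ℕ
ceilDiv r v = ℕD._/_ (r ℕ.+ v ℕ.∸ 1) v

InS : ℕ → ℕ → Set
InS m n = n ≡ 0 ⊎ m ≤ n

InGen1 : ℕ → ℕ → Set
InGen1 a n = ∃ λ i → n ≡ i ℕ.* a

InGen2 : ℕ → ℕ → ℕ → Set
InGen2 a b n = ∃ λ i → ∃ λ j → n ≡ i ℕ.* a ℕ.+ j ℕ.* b

module Submission where

-- When PQ = 0 the Lucas sequence is explicit: U_{k+1} = P^k if Q = 0, while if P = 0 it
-- vanishes at even indices and U_{2i+1} = (-Q)^i.  So every question n ∈ L(P,Q,p^-r) becomes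
-- p^r ∣ a^k for one integer a, which holds iff r ≤ ν_p(a)·k, i.e. iff ⌈r/ν_p(a)⌉ ≤ k.  An a
-- prime to p is the case ν_p(a) = 0, where r ≥ 1 rules out every nonzero term; for P = Q = 0
-- the only nonzero term is U_1 = 1.

open import Data.Empty using (⊥-elim)
open import Data.Product using (∃; _×_; _,_)
open import Data.Sum using (inj₁; inj₂)
open import Function.Base using (_∘_)
open import Function.Bundles using (_⇔_; mk⇔; Equivalence)
open import Function.Properties.Equivalence using (⇔-setoid)
open import Level using (0ℓ)
open import Relation.Binary.PropositionalEquality
  using (_≡_; _≢_; refl; sym; trans; cong; cong₂; subst; module ≡-Reasoning)
import Relation.Binary.Reasoning.Setoid as SetoidReasoning
open import Relation.Nullary using (¬_)

module ⇔-Reasoning = SetoidReasoning (⇔-setoid 0ℓ)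

module PrimePowerDivisibility where

  open import Data.Nat
  open import Data.Nat.Divisibility
  open import Data.Nat.Primality using (Prime; euclidsLemma; prime⇒nonZero; prime⇒nonTrivial)
  open import Data.Nat.Properties
  open import Data.Nat.Solver using (module +-*-Solver)
  open import Relation.Nullary using (yes; no)
  open ≡-Reasoning

  ^-distribʳ-* : ∀ m n k → (m * n) ^ k ≡ m ^ k * n ^ k
  ^-distribʳ-* m n zero    = refl
  ^-distribʳ-* m n (suc k) = begin
    m * n * (m * n) ^ k      ≡⟨ cong (m * n *_) (^-distribʳ-* m n k) ⟩
    m * n * (m ^ k * n ^ k)  ≡⟨ solve 4 (λ m n x y → m :* n :* (x :* y) := m :* x :* (n :* y))
                                  refl m n (m ^ k) (n ^ k) ⟩
    m * m ^ k * (n * n ^ k)  ∎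
    where open +-*-Solver

  ^-monoʳ-∣ : ∀ m {i j} → i ≤ j → m ^ i ∣ m ^ j
  ^-monoʳ-∣ m {i} {j} i≤j = divides (m ^ (j ∸ i)) (begin
    m ^ j                ≡⟨ cong (m ^_) (sym (m∸n+n≡m i≤j)) ⟩
    m ^ (j ∸ i + i)      ≡⟨ ^-distribˡ-+-* m (j ∸ i) i ⟩
    m ^ (j ∸ i) * m ^ i  ∎)

  module _ {p : ℕ} (p-prime : Prime p) where

    private instance
      p≢0 : NonZero p
      p≢0 = prime⇒nonZero p-prime

    p∤1 : ¬ p ∣ 1
    p∤1 p∣1 = nonTrivial⇒≢1 {{prime⇒nonTrivial p-prime}} (∣1⇒≡1 p∣1)

    p∤u⇒p∤u^k : ∀ {u} k → ¬ p ∣ u → ¬ p ∣ u ^ k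
    p∤u⇒p∤u^k zero    p∤u = p∤1
    p∤u⇒p∤u^k {u} (suc k) p∤u p∣u^[1+k] with euclidsLemma u (u ^ k) p-prime p∣u^[1+k]
    ... | inj₁ p∣u   = p∤u p∣u
    ... | inj₂ p∣u^k = p∤u⇒p∤u^k k p∤u p∣u^k

    p^r∣p^s*u⇔r≤s : ∀ {u} r s → ¬ p ∣ u → p ^ r ∣ p ^ s * u ⇔ r ≤ s
    p^r∣p^s*u⇔r≤s {u} r s p∤u = mk⇔ to from
      where
      instance
        p^s≢0 : NonZero (p ^ s)
        p^s≢0 = m^n≢0 p s
      to : p ^ r ∣ p ^ s * u → r ≤ s
      to p^r∣p^s*u with r ≤? s
      ... | yes r≤s = r≤s
      ... | no  r≰s = ⊥-elim (p∤u (*-cancelˡ-∣ (p ^ s) p^s*p∣p^s*u))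
        where
        p^s*p∣p^s*u : p ^ s * p ∣ p ^ s * u
        p^s*p∣p^s*u = subst (_∣ p ^ s * u) (*-comm p (p ^ s))
                        (∣-trans (^-monoʳ-∣ p (≰⇒> r≰s)) p^r∣p^s*u)
      from : r ≤ s → p ^ r ∣ p ^ s * u
      from r≤s = ∣-trans (^-monoʳ-∣ p r≤s) (m∣m*n u)

    exact-power-factor : ∀ {a v} → p ^ v ∣ a → ¬ p ^ suc v ∣ a →
                         ∃ λ u → ¬ p ∣ u × a ≡ p ^ v * u
    exact-power-factor {v = v} (divides u a≡u*p^v) p^[1+v]∤a =
      u , p∤u , trans a≡u*p^v (*-comm u (p ^ v))
      where
      p∤u : ¬ p ∣ u
      p∤u p∣u = p^[1+v]∤a (subst (p * p ^ v ∣_) (sym a≡u*p^v) (*-monoˡ-∣ (p ^ v) p∣u))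

    p^r∣a^k⇔r≤v*k : ∀ {a v} → p ^ v ∣ a → ¬ p ^ suc v ∣ a → ∀ r k → p ^ r ∣ a ^ k ⇔ r ≤ v * k
    p^r∣a^k⇔r≤v*k {v = v} p^v∣a p^[1+v]∤a r k with exact-power-factor {v = v} p^v∣a p^[1+v]∤a
    ... | u , p∤u , refl =
      subst (λ x → p ^ r ∣ x ⇔ r ≤ v * k) (sym a^k≡p^[v*k]*u^k)
            (p^r∣p^s*u⇔r≤s r (v * k) (p∤u⇒p∤u^k k p∤u))
      where
      a^k≡p^[v*k]*u^k : (p ^ v * u) ^ k ≡ p ^ (v * k) * u ^ k
      a^k≡p^[v*k]*u^k = trans (^-distribʳ-* (p ^ v) u k) (cong (_* u ^ k) (^-*-assoc p v k))

module NumericalSemigroups where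

  open import Data.Nat hiding (parity)
  open import Data.Nat.Solver using (module +-*-Solver)
  open import Data.Nat.DivMod using (_/_; _%_; m≡m%n+[m/n]*n; m%n<n; m<n*o⇒m/o<n)
  open import Data.Nat.Properties
  open import Defs using (ceilDiv; InS; InGen1; InGen2)

  m/n<k⇔m<k*n : ∀ m n .{{_ : NonZero n}} k → m / n < k ⇔ m < k * n
  m/n<k⇔m<k*n m n k = mk⇔ to m<n*o⇒m/o<n
    where
    to : m / n < k → m < k * n
    to m/n<k = begin-strict
      m                    ≡⟨ m≡m%n+[m/n]*n m n ⟩
      m % n + m / n * n    <⟨ +-monoˡ-< (m / n * n) (m%n<n m n) ⟩
      n + m / n * n        ≤⟨ *-monoˡ-≤ n m/n<k ⟩
      k * n                ∎
      where open ≤-Reasoning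

  ceilDiv≤k⇔r≤v*k : ∀ r v .{{_ : NonZero v}} k → ceilDiv r v ≤ k ⇔ r ≤ v * k
  ceilDiv≤k⇔r≤v*k r v@(suc w) k = begin
    ceilDiv r v ≤ k            ≈⟨ mk⇔ s≤s s≤s⁻¹ ⟩
    (r + v ∸ 1) / v < suc k    ≈⟨ m/n<k⇔m<k*n (r + v ∸ 1) v (suc k) ⟩
    r + v ∸ 1 < suc k * v      ≡⟨ cong (_< suc k * v) (cong (_∸ 1) (+-suc r w)) ⟩
    r + w < suc (w + k * v)    ≈⟨ mk⇔ to from ⟩
    r ≤ v * k                  ∎
    where
    open ⇔-Reasoning
    to : r + w < suc (w + k * v) → r ≤ v * k
    to r+w<1+w+kv = subst (r ≤_) (*-comm k v)
      (+-cancelʳ-≤ w r (k * v) (subst (r + w ≤_) (+-comm w (k * v)) (s≤s⁻¹ r+w<1+w+kv)))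
    from : r ≤ v * k → r + w < suc (w + k * v)
    from r≤vk = s≤s (subst (r + w ≤_) (trans (cong (_+ w) (*-comm v k)) (+-comm (k * v) w))
      (+-monoˡ-≤ w r≤vk))

  InS[1+c][1+k]⇔c≤k : ∀ c k → InS (suc c) (suc k) ⇔ c ≤ k
  InS[1+c][1+k]⇔c≤k c k = mk⇔ (λ { (inj₁ ()) ; (inj₂ (s≤s c≤k)) → c≤k }) (λ c≤k → inj₂ (s≤s c≤k))

  data Parity : ℕ → Set where
    even : ∀ i → Parity (i * 2)
    odd  : ∀ i → Parity (suc (i * 2))

  parity : ∀ n → Parity n
  parity zero = even 0
  parity (suc n) with parity n
  ... | even i = odd i
  ... | odd i  = even (suc i)

  odd≢even : ∀ i j → suc (i * 2) ≢ j * 2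
  odd≢even zero    zero    ()
  odd≢even (suc i) (suc j) 3+2i≡2+2j = odd≢even i j (cong (pred ∘ pred) 3+2i≡2+2j)

  odd∉⟨2⟩ : ∀ i → ¬ InGen1 2 (suc (i * 2))
  odd∉⟨2⟩ i (j , 1+2i≡2j) = odd≢even i j 1+2i≡2j

  even∈⟨2,b⟩ : ∀ b i → InGen2 2 b (i * 2)
  even∈⟨2,b⟩ b i = i , 0 , sym (+-identityʳ (i * 2))

  odd∈⟨2,1+2c⟩⇔c≤i : ∀ c i → InGen2 2 (suc (2 * c)) (suc (i * 2)) ⇔ c ≤ i
  odd∈⟨2,1+2c⟩⇔c≤i c i = mk⇔ to from
    where
    to : InGen2 2 (suc (2 * c)) (suc (i * 2)) → c ≤ i
    to (a , zero , 1+2i≡2a+0) = ⊥-elim (odd≢even i a (trans 1+2i≡2a+0 (+-identityʳ (a * 2))))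
    to (a , suc j , 1+2i≡2a+[1+j][1+2c]) =
      *-cancelʳ-≤ c i 2 (subst (_≤ i * 2) (*-comm 2 c) (s≤s⁻¹ 1+2c≤1+2i))
      where
      1+2c≤1+2i : suc (2 * c) ≤ suc (i * 2)
      1+2c≤1+2i = subst (suc (2 * c) ≤_) (sym 1+2i≡2a+[1+j][1+2c])
        (≤-trans (m≤m+n (suc (2 * c)) (j * suc (2 * c))) (m≤n+m _ (a * 2)))
    from : c ≤ i → InGen2 2 (suc (2 * c)) (suc (i * 2))
    from c≤i = i ∸ c , 1 , (begin
      suc (i * 2)                    ≡⟨ cong (λ x → suc (x * 2)) (sym (m+[n∸m]≡n c≤i)) ⟩
      suc ((c + (i ∸ c)) * 2)        ≡⟨ solve 2 (λ c d → con 1 :+ (c :+ d) :* con 2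
                                           := d :* con 2 :+ con 1 :* (con 1 :+ con 2 :* c))
                                           refl c (i ∸ c) ⟩
      (i ∸ c) * 2 + 1 * suc (2 * c)  ∎)
      where open ≡-Reasoning; open +-*-Solver

open import Defs
open import Data.Nat using (ℕ; zero; suc; _≥_; NonZero) renaming (_*_ to _*ℕ_)
open import Data.Nat.Primality using (Prime)
open import Data.Integer using (ℤ; +_; _*_; -_; _-_; _^_; ∣_∣)
open import Data.Integer.Divisibility using (_∣_)
import Data.Nat as ℕ
import Data.Nat.Divisibility as ℕ
import Data.Nat.Properties as ℕ
import Data.Integer.Properties as ℤ

open PrimePowerDivisibility using (p∤1; p^r∣a^k⇔r≤v*k)
open NumericalSemigroups

∣i^n∣≡∣i∣^n : ∀ i n → ∣ i ^ n ∣ ≡ ∣ i ∣ ℕ.^ n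
∣i^n∣≡∣i∣^n i zero    = refl
∣i^n∣≡∣i∣^n i (suc n) = trans (ℤ.abs-* i (i ^ n)) (cong (∣ i ∣ ℕ.*_) (∣i^n∣≡∣i∣^n i n))

[+p]^r∣i⇔p^r∣∣i∣ : ∀ p r i → ((+ p) ^ r ∣ i) ⇔ (p ℕ.^ r ℕ.∣ ∣ i ∣)
[+p]^r∣i⇔p^r∣∣i∣ p r i =
  mk⇔ (subst (ℕ._∣ ∣ i ∣) ∣[+p]^r∣≡p^r) (subst (ℕ._∣ ∣ i ∣) (sym ∣[+p]^r∣≡p^r))
  where
  ∣[+p]^r∣≡p^r : ∣ (+ p) ^ r ∣ ≡ p ℕ.^ r
  ∣[+p]^r∣≡p^r = ∣i^n∣≡∣i∣^n (+ p) r

∣-i⇔∣i : ∀ k i → (k ∣ - i) ⇔ (k ∣ i)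
∣-i⇔∣i k i = mk⇔ (subst (∣ k ∣ ℕ.∣_) (ℤ.∣-i∣≡∣i∣ i)) (subst (∣ k ∣ ℕ.∣_) (sym (ℤ.∣-i∣≡∣i∣ i)))

∤⇒IsVal-0 : ∀ {p} a → ¬ (+ p) ∣ a → IsVal p a 0
∤⇒IsVal-0 {p} a p∤a = ℕ.1∣ ∣ a ∣ , λ p^1∣a → p∤a (subst (_∣ a) (ℤ.^-identityʳ (+ p)) p^1∣a)

IsVal-neg : ∀ {p} a v → IsVal p a v → IsVal p (- a) v
IsVal-neg {p} a v (p^v∣a , p^[1+v]∤a) =
  from (∣-i⇔∣i ((+ p) ^ v) a) p^v∣a ,
  λ p^[1+v]∣-a → p^[1+v]∤a (to (∣-i⇔∣i ((+ p) ^ suc v) a) p^[1+v]∣-a)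
  where open Equivalence

[+p]^r∣a^k⇔r≤v*k : ∀ {p} → Prime p → ∀ a v → IsVal p a v → ∀ r k →
                   ((+ p) ^ r ∣ a ^ k) ⇔ (r ℕ.≤ v *ℕ k)
[+p]^r∣a^k⇔r≤v*k {p} p-prime a v (p^v∣a , p^[1+v]∤a) r k = begin
  (+ p) ^ r ∣ a ^ k         ≈⟨ [+p]^r∣i⇔p^r∣∣i∣ p r (a ^ k) ⟩
  p ℕ.^ r ℕ.∣ ∣ a ^ k ∣     ≡⟨ cong (p ℕ.^ r ℕ.∣_) (∣i^n∣≡∣i∣^n a k) ⟩
  p ℕ.^ r ℕ.∣ ∣ a ∣ ℕ.^ k   ≈⟨ p^r∣a^k⇔r≤v*k p-prime {v = v} (to ([+p]^r∣i⇔p^r∣∣i∣ p v a) p^v∣a)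
                                 (p^[1+v]∤a ∘ from ([+p]^r∣i⇔p^r∣∣i∣ p (suc v) a)) r k ⟩
  r ℕ.≤ v *ℕ k              ∎
  where open ⇔-Reasoning; open Equivalence

U[P,0,1+k]≡P^k : ∀ P k → U P (+ 0) (suc k) ≡ P ^ k
U[P,0,1+k]≡P^k P zero    = refl
U[P,0,1+k]≡P^k P (suc k) = begin
  P * U P (+ 0) (suc k) - + 0 * U P (+ 0) k
    ≡⟨ cong₂ _-_ (cong (P *_) (U[P,0,1+k]≡P^k P k)) (ℤ.*-zeroˡ (U P (+ 0) k)) ⟩
  P * P ^ k - + 0
    ≡⟨ ℤ.+-identityʳ (P * P ^ k) ⟩
  P * P ^ k
    ∎
  where open ≡-Reasoning

U[0,Q,2i]≡0 : ∀ Q i → U (+ 0) Q (i *ℕ 2) ≡ + 0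
U[0,Q,2i]≡0 Q zero    = refl
U[0,Q,2i]≡0 Q (suc i) = begin
  + 0 * U (+ 0) Q (suc (i *ℕ 2)) - Q * U (+ 0) Q (i *ℕ 2)
    ≡⟨ cong₂ _-_ (ℤ.*-zeroˡ (U (+ 0) Q (suc (i *ℕ 2)))) (cong (Q *_) (U[0,Q,2i]≡0 Q i)) ⟩
  + 0 - Q * + 0
    ≡⟨ cong (_-_ (+ 0)) (ℤ.*-zeroʳ Q) ⟩
  + 0
    ∎
  where open ≡-Reasoning

U[0,Q,2i+1]≡[-Q]^i : ∀ Q i → U (+ 0) Q (suc (i *ℕ 2)) ≡ (- Q) ^ i
U[0,Q,2i+1]≡[-Q]^i Q zero    = refl
U[0,Q,2i+1]≡[-Q]^i Q (suc i) = begin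
  + 0 * U (+ 0) Q (suc (suc (i *ℕ 2))) - Q * U (+ 0) Q (suc (i *ℕ 2))
    ≡⟨ cong₂ _-_ (ℤ.*-zeroˡ (U (+ 0) Q (suc (suc (i *ℕ 2))))) (cong (Q *_) (U[0,Q,2i+1]≡[-Q]^i Q i)) ⟩
  + 0 - Q * (- Q) ^ i
    ≡⟨ ℤ.+-identityˡ (- (Q * (- Q) ^ i)) ⟩
  - (Q * (- Q) ^ i)
    ≡⟨ ℤ.neg-distribˡ-* Q ((- Q) ^ i) ⟩
  - Q * (- Q) ^ i
    ∎
  where open ≡-Reasoning

module _ {p : ℕ} (p-prime : Prime p) (r : ℕ) where

  open Equivalence

  U≡0⇒InL : ∀ P Q n → U P Q n ≡ + 0 → InL P Q p r n
  U≡0⇒InL P Q n U≡0 = subst ((+ p) ^ r ∣_) (sym U≡0) (ℕ._∣0 _)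

  InL[P,0,1+k]⇔r≤v*k : ∀ P v → IsVal p P v → ∀ k → InL P (+ 0) p r (suc k) ⇔ r ℕ.≤ v *ℕ k
  InL[P,0,1+k]⇔r≤v*k P v ν k =
    subst (λ x → ((+ p) ^ r ∣ x) ⇔ r ℕ.≤ v *ℕ k) (sym (U[P,0,1+k]≡P^k P k))
          ([+p]^r∣a^k⇔r≤v*k p-prime P v ν r k)

  InL[0,Q,2i+1]⇔r≤v*i : ∀ Q v → IsVal p Q v → ∀ i → InL (+ 0) Q p r (suc (i *ℕ 2)) ⇔ r ℕ.≤ v *ℕ i
  InL[0,Q,2i+1]⇔r≤v*i Q v ν i =
    subst (λ x → ((+ p) ^ r ∣ x) ⇔ r ℕ.≤ v *ℕ i) (sym (U[0,Q,2i+1]≡[-Q]^i Q i))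
          ([+p]^r∣a^k⇔r≤v*k p-prime (- Q) v (IsVal-neg Q v ν) r i)

  InL[P,0]⇔n≡0 : ∀ P → r ≥ 1 → ¬ (+ p) ∣ P → ∀ n → InL P (+ 0) p r n ⇔ (n ≡ 0)
  InL[P,0]⇔n≡0 P r≥1 p∤P zero    = mk⇔ (λ _ → refl) (λ _ → U≡0⇒InL P (+ 0) 0 refl)
  InL[P,0]⇔n≡0 P r≥1 p∤P (suc k) =
    mk⇔ (⊥-elim ∘ ℕ.<⇒≱ r≥1 ∘ to (InL[P,0,1+k]⇔r≤v*k P 0 (∤⇒IsVal-0 P p∤P) k)) (λ ())

  InL[P,0]⇔InS : ∀ P v .{{_ : NonZero v}} → IsVal p P v →
                 ∀ n → InL P (+ 0) p r n ⇔ InS (suc (ceilDiv r v)) n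
  InL[P,0]⇔InS P v ν zero    = mk⇔ (λ _ → inj₁ refl) (λ _ → U≡0⇒InL P (+ 0) 0 refl)
  InL[P,0]⇔InS P v ν (suc k) = begin
    InL P (+ 0) p r (suc k)          ≈⟨ InL[P,0,1+k]⇔r≤v*k P v ν k ⟩
    r ℕ.≤ v *ℕ k                     ≈⟨ ceilDiv≤k⇔r≤v*k r v k ⟨
    ceilDiv r v ℕ.≤ k                ≈⟨ InS[1+c][1+k]⇔c≤k (ceilDiv r v) k ⟨
    InS (suc (ceilDiv r v)) (suc k)  ∎
    where open ⇔-Reasoning

  InL[0,Q]⇔InGen1 : ∀ Q → r ≥ 1 → ¬ (+ p) ∣ Q → ∀ n → InL (+ 0) Q p r n ⇔ InGen1 2 n
  InL[0,Q]⇔InGen1 Q r≥1 p∤Q n with parity n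
  ... | even i = mk⇔ (λ _ → i , refl) (λ _ → U≡0⇒InL (+ 0) Q (i *ℕ 2) (U[0,Q,2i]≡0 Q i))
  ... | odd i  = mk⇔ (⊥-elim ∘ ℕ.<⇒≱ r≥1 ∘ to (InL[0,Q,2i+1]⇔r≤v*i Q 0 (∤⇒IsVal-0 Q p∤Q) i))
                     (⊥-elim ∘ odd∉⟨2⟩ i)

  InL[0,Q]⇔InGen2 : ∀ Q v .{{_ : NonZero v}} → IsVal p Q v →
                    ∀ n → InL (+ 0) Q p r n ⇔ InGen2 2 (suc (2 *ℕ ceilDiv r v)) n
  InL[0,Q]⇔InGen2 Q v ν n with parity n
  ... | even i = mk⇔ (λ _ → even∈⟨2,b⟩ (suc (2 *ℕ ceilDiv r v)) i)
                     (λ _ → U≡0⇒InL (+ 0) Q (i *ℕ 2) (U[0,Q,2i]≡0 Q i))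
  ... | odd i  = begin
    InL (+ 0) Q p r (suc (i *ℕ 2))                        ≈⟨ InL[0,Q,2i+1]⇔r≤v*i Q v ν i ⟩
    r ℕ.≤ v *ℕ i                                          ≈⟨ ceilDiv≤k⇔r≤v*k r v i ⟨
    ceilDiv r v ℕ.≤ i                                     ≈⟨ odd∈⟨2,1+2c⟩⇔c≤i (ceilDiv r v) i ⟨
    InGen2 2 (suc (2 *ℕ ceilDiv r v)) (suc (i *ℕ 2))      ∎
    where open ⇔-Reasoning

  InL[0,0]⇔InS₂ : r ≥ 1 → ∀ n → InL (+ 0) (+ 0) p r n ⇔ InS 2 n
  InL[0,0]⇔InS₂ r≥1 zero          = mk⇔ (λ _ → inj₁ refl) (λ _ → U≡0⇒InL (+ 0) (+ 0) 0 refl)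
  InL[0,0]⇔InS₂ r≥1 (suc zero)    =
    mk⇔ (⊥-elim ∘ ℕ.<⇒≱ r≥1 ∘ to ([+p]^r∣a^k⇔r≤v*k p-prime (+ 1) 0 (∤⇒IsVal-0 (+ 1) (p∤1 p-prime)) r 0))
        (λ { (inj₁ ()) ; (inj₂ (ℕ.s≤s ())) })
  InL[0,0]⇔InS₂ r≥1 (suc (suc m)) =
    mk⇔ (λ _ → inj₂ (ℕ.s≤s (ℕ.s≤s ℕ.z≤n)))
        (λ _ → U≡0⇒InL (+ 0) (+ 0) (suc (suc m))
                 (trans (U[P,0,1+k]≡P^k (+ 0) (suc m)) (ℤ.*-zeroˡ ((+ 0) ^ m))))

theorem3p1 : (P Q : ℤ) → P * Q ≡ + 0 → (p : ℕ) → Prime p → (r : ℕ) → r ≥ 1 →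
    ((P ≢ + 0) → Q ≡ + 0 → ¬ ((+ p) ∣ P) → ∀ n → InL P Q p r n ⇔ (n ≡ 0))
    × ((P ≢ + 0) → Q ≡ + 0 → (+ p) ∣ P → (v : ℕ) → .{{_ : NonZero v}} → IsVal p P v →
        ∀ n → InL P Q p r n ⇔ InS (suc (ceilDiv r v)) n)
    × (P ≡ + 0 → (Q ≢ + 0) → ¬ ((+ p) ∣ Q) → ∀ n → InL P Q p r n ⇔ InGen1 2 n)
    × (P ≡ + 0 → (Q ≢ + 0) → (+ p) ∣ Q → (v : ℕ) → .{{_ : NonZero v}} → IsVal p Q v →
        ∀ n → InL P Q p r n ⇔ InGen2 2 (suc (2 *ℕ ceilDiv r v)) n)
    × (P ≡ + 0 → Q ≡ + 0 → ∀ n → InL P Q p r n ⇔ InS 2 n)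
theorem3p1 P Q _ p p-prime r r≥1 =
    (λ { _ refl p∤P → InL[P,0]⇔n≡0 p-prime r P r≥1 p∤P })
  , (λ { _ refl _ v ν → InL[P,0]⇔InS p-prime r P v ν })
  , (λ { refl _ p∤Q → InL[0,Q]⇔InGen1 p-prime r Q r≥1 p∤Q })
  , (λ { refl _ _ v ν → InL[0,Q]⇔InGen2 p-prime r Q v ν })
  , (λ { refl refl → InL[0,0]⇔InS₂ p-prime r r≥1 })
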